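{- Let $U$ be a relation scheme with $n\le 2$ attributes and truth lattices $L_A$ ($A\in U$). Then for every schema interpretation $g$ and every $L\in \mathrm{Sb}(L_U)$, the family $g(L)=\{g(x):x\in L\}$ (vectors of $\{0,1\}^n$ read as subsets of $U$) is a closure system over $U$.
   Context: Each attribute $A$ of $U=\{A_1,\dots,A_n\}$ has a finite lattice $L_A$ with bottom $0_A$ and top $1_A$; $L_U=\prod_{A\in U}L_A$ with componentwise order. $\mathrm{Sb}(L_U)$ is the set of subsets $L\subseteq L_U$ that contain the top element of $L_U$ and are closed under binary meets of $L_U$. An attribute interpretation of $A$ is an increasing map $h_A:L_A\to\{0,1\}$ with $h_A(0_A)=0$, $h_A(1_A)=1$; a schema interpretation is $g(\langle x_1,\dots,x_n\rangle)=\langle h_{A_1}(x_1),\dots,h_{A_n}(x_n)\rangle$, a vector in $\{0,1\}^n$ identified with the subset of $U$ of attributes with value $1$. A closure system over $U$ is a family of subsets of $U$ containing $U$ and closed under intersection. -}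

module Defs where

open import Level using (Level; _⊔_) renaming (suc to lsuc)
open import Data.Nat using (ℕ)
open import Data.Fin using (Fin)
open import Data.Bool using (Bool; true; false) renaming (_≤_ to _≤ᵇ_)
open import Data.Fin.Subset using (Subset; _∩_; ⊤)
open import Data.Vec using (tabulate)
open import Data.List using (List)
open import Data.List.Relation.Unary.Any using (Any)
open import Data.Product using (Σ; ∃; _×_)
open import Relation.Binary.PropositionalEquality using (_≡_)
open import Relation.Binary.Lattice.Bundles using (BoundedLattice)

-- A finite lattice: a bounded lattice whose carrier is covered (up to ≈) by a finite list.
-- (A finite lattice is automatically bounded.)
IsFinite : ∀ {c ℓ₁ ℓ₂} → BoundedLattice c ℓ₁ ℓ₂ → Set (c ⊔ ℓ₁)
IsFinite L = Σ (List Carrier) λ xs → ∀ x → Any (x ≈_) xs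
  where open BoundedLattice L

module _ {c ℓ₁ ℓ₂ : Level} {n : ℕ} (Lat : Fin n → BoundedLattice c ℓ₁ ℓ₂) where
  open BoundedLattice

  LU : Set c
  LU = (i : Fin n) → Carrier (Lat i)

  ⊤U : LU
  ⊤U i = BoundedLattice.⊤ (Lat i)

  _∧U_ : LU → LU → LU
  (x ∧U y) i = _∧_ (Lat i) (x i) (y i)

  record InSb {p} (L : LU → Set p) : Set (c ⊔ p) where
    field
      top-mem  : L ⊤U
      meet-mem : ∀ x y → L x → L y → L (x ∧U y)

  record AttrInterp (i : Fin n) : Set (c ⊔ ℓ₂) where
    field
      h      : Carrier (Lat i) → Bool
      mono   : ∀ {x y} → _≤_ (Lat i) x y → h x ≤ᵇ h y
      h-bot  : h (BoundedLattice.⊥ (Lat i)) ≡ false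
      h-top  : h (BoundedLattice.⊤ (Lat i)) ≡ true

  SchemaInterp : Set (c ⊔ ℓ₂)
  SchemaInterp = (i : Fin n) → AttrInterp i

  applyInterp : SchemaInterp → LU → Subset n
  applyInterp hs x = tabulate (λ i → AttrInterp.h (hs i) (x i))

  image : ∀ {p} → SchemaInterp → (LU → Set p) → Subset n → Set (c ⊔ p)
  image hs L v = ∃ λ x → L x × applyInterp hs x ≡ v

-- A closure system over U = Fin n: a family of subsets of U containing U and closed
-- under intersection (for a family of subsets of a finite set: binary intersections).
record IsClosureSystem {n : ℕ} {p} (F : Subset n → Set p) : Set p where
  field
    has-U     : F ⊤
    closed-∩  : ∀ a b → F a → F b → F (a ∩ b)

-- The family g(L) contains U because
-- every h_A sends the top of L_A to 1, so g(⊤) = U.  For closure under ∩, take x, y ∈ L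
-- and put a = g(x), b = g(y).  Since each h_A is monotone and x ∧ y ≤ x, y, we get
-- g(x ∧ y) ⊆ a ∩ b, for any number of attributes.  The restriction n ≤ 2 enters only
-- through a purely combinatorial fact: two subsets of a set with at most two elements
-- are comparable or disjoint, so a ∩ b is a, b or ∅.  In the first two cases a ∩ b is
-- the image of x resp. y; in the last, g(x ∧ y) ⊆ ∅ forces a ∩ b = ∅ = g(x ∧ y), the
-- image of x ∧ y ∈ L.
module Submission where

open import Defs
open import Level using (Level)
open import Data.Nat using (ℕ; _≤_; z≤n; s≤s)
open import Data.Fin using (Fin)
open import Data.Bool using (Bool; true; false) renaming (_≤_ to _≤ᵇ_)
open import Data.Bool.Base using (b≤b)
open import Data.Vec using ([]; _∷_; tabulate)
open import Data.Vec.Properties using ([]=⇒lookup; lookup⇒[]=; lookup∘tabulate)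
open import Data.Fin.Subset using (Subset; _∩_; _∈_; _⊆_; ⊥; ⊤)
open import Data.Fin.Subset.Properties using (⊆-antisym; ⊥⊆; ⊆⊤; x∈p∩q⁺)
open import Data.Sum using (_⊎_; inj₁; inj₂)
open import Data.Product using (_,_)
open import Relation.Binary.PropositionalEquality using (_≡_; refl; sym; trans; subst)
open import Relation.Binary.Lattice.Bundles using (BoundedLattice)

∈-tabulate⁻ : ∀ {n} {f : Fin n → Bool} {i : Fin n} → i ∈ tabulate f → f i ≡ true
∈-tabulate⁻ {f = f} {i} i∈ = trans (sym (lookup∘tabulate f i)) ([]=⇒lookup i∈)

∈-tabulate⁺ : ∀ {n} {f : Fin n → Bool} {i : Fin n} → f i ≡ true → i ∈ tabulate f
∈-tabulate⁺ {f = f} {i} fi≡true = lookup⇒[]= i (tabulate f) (trans (lookup∘tabulate f i) fi≡true)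

true-upward : ∀ {a b} → a ≤ᵇ b → a ≡ true → b ≡ true
true-upward b≤b refl = refl

meet-trichotomy : ∀ {n} → n ≤ 2 → (a b : Subset n) →
  (a ∩ b ≡ a) ⊎ (a ∩ b ≡ b) ⊎ (a ∩ b ≡ ⊥)
meet-trichotomy z≤n               []                   []                   = inj₁ refl
meet-trichotomy (s≤s z≤n)         (false ∷ [])         (_ ∷ [])             = inj₁ refl
meet-trichotomy (s≤s z≤n)         (true ∷ [])          (_ ∷ [])             = inj₂ (inj₁ refl)
meet-trichotomy (s≤s (s≤s z≤n))   (false ∷ false ∷ []) (_ ∷ _ ∷ [])         = inj₁ refl
meet-trichotomy (s≤s (s≤s z≤n))   (true ∷ true ∷ [])   (_ ∷ _ ∷ [])         = inj₂ (inj₁ refl)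
meet-trichotomy (s≤s (s≤s z≤n))   (true ∷ false ∷ [])  (true ∷ _ ∷ [])      = inj₁ refl
meet-trichotomy (s≤s (s≤s z≤n))   (true ∷ false ∷ [])  (false ∷ false ∷ []) = inj₂ (inj₁ refl)
meet-trichotomy (s≤s (s≤s z≤n))   (true ∷ false ∷ [])  (false ∷ true ∷ [])  = inj₂ (inj₂ refl)
meet-trichotomy (s≤s (s≤s z≤n))   (false ∷ true ∷ [])  (_ ∷ true ∷ [])      = inj₁ refl
meet-trichotomy (s≤s (s≤s z≤n))   (false ∷ true ∷ [])  (false ∷ false ∷ []) = inj₂ (inj₁ refl)
meet-trichotomy (s≤s (s≤s z≤n))   (false ∷ true ∷ [])  (true ∷ false ∷ [])  = inj₂ (inj₂ refl)

module _ {c ℓ₁ ℓ₂ : Level} {n : ℕ} (Lat : Fin n → BoundedLattice c ℓ₁ ℓ₂)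
         (g : SchemaInterp Lat) where

  private
    gᵢ : LU Lat → Subset n
    gᵢ = applyInterp Lat g

  interp-top : gᵢ (⊤U Lat) ≡ ⊤
  interp-top = ⊆-antisym ⊆⊤ (λ {i} _ → ∈-tabulate⁺ (AttrInterp.h-top (g i)))

  -- g is meet-subadditive: g(x ∧ y) ⊆ g(x) ∩ g(y), by monotonicity of each h_A.
  interp-meet-⊆ : ∀ x y → gᵢ (_∧U_ Lat x y) ⊆ gᵢ x ∩ gᵢ y
  interp-meet-⊆ x y {i} i∈ = x∈p∩q⁺ (below (x∧y≤x (x i) (y i)) , below (x∧y≤y (x i) (y i)))
    where
    open BoundedLattice (Lat i) using (_∧_; x∧y≤x; x∧y≤y) renaming (_≤_ to _≤ᵢ_)
    below : ∀ {w : LU Lat} → (x i ∧ y i) ≤ᵢ w i → i ∈ gᵢ w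
    below le = ∈-tabulate⁺ (true-upward (AttrInterp.mono (g i) le) (∈-tabulate⁻ i∈))

  -- The meet of two points of g(L) lies in g(L) as soon as it is one of them or empty:
  -- then it is the image of x, of y, or (being squeezed below ∅) of x ∧ y ∈ L.
  image-∩-of-trichotomy : ∀ {p} {L : LU Lat → Set p} → InSb Lat L → ∀ x y → L x → L y →
    (gᵢ x ∩ gᵢ y ≡ gᵢ x) ⊎ (gᵢ x ∩ gᵢ y ≡ gᵢ y) ⊎ (gᵢ x ∩ gᵢ y ≡ ⊥) →
    image Lat g L (gᵢ x ∩ gᵢ y)
  image-∩-of-trichotomy sb x y Lx Ly (inj₁ meet≡x)        = x , Lx , sym meet≡x
  image-∩-of-trichotomy sb x y Lx Ly (inj₂ (inj₁ meet≡y)) = y , Ly , sym meet≡y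
  image-∩-of-trichotomy sb x y Lx Ly (inj₂ (inj₂ meet≡∅)) =
    _∧U_ Lat x y , InSb.meet-mem sb x y Lx Ly ,
    ⊆-antisym (interp-meet-⊆ x y) (λ {i} i∈meet → ⊥⊆ (subst (i ∈_) meet≡∅ i∈meet))

proposition3 : {c ℓ₁ ℓ₂ p : Level} (n : ℕ) → n ≤ 2 →
    (Lat : Fin n → BoundedLattice c ℓ₁ ℓ₂) → ((i : Fin n) → IsFinite (Lat i)) →
    (g : SchemaInterp Lat) → (L : LU Lat → Set p) → InSb Lat L →
    IsClosureSystem (image Lat g L)
proposition3 n n≤2 Lat _ g L sb = record
  { has-U    = ⊤U Lat , InSb.top-mem sb , interp-top Lat g
  ; closed-∩ = closed
  }
  where
  closed : ∀ a b → image Lat g L a → image Lat g L b → image Lat g L (a ∩ b)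
  closed _ _ (x , Lx , refl) (y , Ly , refl) =
    image-∩-of-trichotomy Lat g sb x y Lx Ly
      (meet-trichotomy n≤2 (applyInterp Lat g x) (applyInterp Lat g y))
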